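{- Let $n>0$. Then \[ \alpha_n(t,q)=\sum_{\substack{i,j\ge0\\ i+j\le n-1}}t^i(q-t)^j(1-t)^{n-i-j-1}\,2^i\,(i+j+1)!\binom{i+j}{j}S(n,i+j+1). \]
   Context: A segmented permutation of size $n$ is a permutation $\sigma=\sigma_1\cdots\sigma_n$ of $\{1,\dots,n\}$, written as a word, together with a choice, for each position $i\in\{1,\dots,n-1\}$, of whether or not a bar is placed between $\sigma_i$ and $\sigma_{i+1}$. $SP_n$ is the set of these. A position $i<n$ is a segmentation if there is a bar between $\sigma_i$ and $\sigma_{i+1}$, and a descent if it is not a segmentation and $\sigma_i>\sigma_{i+1}$. $\operatorname{des}(\sigma)$, $\operatorname{seg}(\sigma)$ are the numbers of descents and segmentations. $\alpha_n(t,q)=\sum_{\sigma\in SP_n}t^{\operatorname{des}(\sigma)}q^{\operatorname{seg}(\sigma)}$. $S(n,k)$ denotes the Stirling numbers of the second kind. -}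

module Defs where

open import Data.Nat as ℕ using (ℕ; zero; suc; _<ᵇ_; _∸_; _!)
open import Data.Nat.Combinatorics using (_C_)
open import Data.Bool using (Bool; true; false; if_then_else_; not; _∧_)
open import Data.Fin using (Fin; toℕ; _≟_)
open import Data.List using (List; []; _∷_; map; foldr; concatMap; filter; allFin; upTo)
open import Relation.Nullary.Decidable using (⌊_⌋)
open import Data.Product using (_×_; _,_)
open import Data.Integer as ℤ using (ℤ; +_; _+_; _-_; _*_; _^_)

sumℤ : List ℤ → ℤ
sumℤ = foldr _+_ (+ 0)

words : {A : Set} → List A → ℕ → List (List A)
words as zero = [] ∷ []
words as (suc k) = concatMap (λ a → map (a ∷_) (words as k)) as

elemFin : {n : ℕ} → Fin n → List (Fin n) → Bool
elemFin x [] = false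
elemFin x (y ∷ ys) = if ⌊ x ≟ y ⌋ then true else elemFin x ys

noDup : {n : ℕ} → List (Fin n) → Bool
noDup [] = true
noDup (x ∷ xs) = not (elemFin x xs) ∧ noDup xs

-- Permutations of {1,…,n}, written as words σ₁⋯σₙ; letter k ∈ Fin n
-- stands for the value k+1 (this shift does not affect comparisons).
perms : (n : ℕ) → List (List ℕ)
perms n = map (map toℕ) (filter (λ w → noDup w B.≟ true) (words (allFin n) n))
  where import Data.Bool as B

-- Bar choices: one Bool for each position i ∈ {1,…,n-1}
-- (true = a bar between σᵢ and σᵢ₊₁).
bars : (n : ℕ) → List (List Bool)
bars n = words (true ∷ false ∷ []) (n ∸ 1)

SP : (n : ℕ) → List (List ℕ × List Bool)
SP n = concatMap (λ w → map (w ,_) (bars n)) (perms n)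

seg : List ℕ → List Bool → ℕ
seg (x ∷ y ∷ xs) (true ∷ bs) = suc (seg (y ∷ xs) bs)
seg (x ∷ y ∷ xs) (false ∷ bs) = seg (y ∷ xs) bs
seg _ _ = 0

des : List ℕ → List Bool → ℕ
des (x ∷ y ∷ xs) (true ∷ bs) = des (y ∷ xs) bs
des (x ∷ y ∷ xs) (false ∷ bs) = (if y <ᵇ x then 1 else 0) ℕ.+ des (y ∷ xs) bs
des _ _ = 0

α : ℕ → ℤ → ℤ → ℤ
α n t q = sumℤ (map (λ { (w , b) → (t ^ des w b) * (q ^ seg w b) }) (SP n))

S : ℕ → ℕ → ℕ
S zero zero = 1
S zero (suc k) = 0
S (suc n) zero = 0
S (suc n) (suc k) = suc k ℕ.* S n (suc k) ℕ.+ S n k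

rhs : ℕ → ℤ → ℤ → ℤ
rhs n t q = sumℤ (map (λ i → sumℤ (map (λ j →
    (t ^ i) * ((q - t) ^ j) * ((+ 1 - t) ^ (n ∸ i ∸ j ∸ 1))
      * (+ (2 ℕ.^ i ℕ.* (suc (i ℕ.+ j)) ! ℕ.* ((i ℕ.+ j) C j) ℕ.* S n (suc (i ℕ.+ j)))))
    (upTo (n ∸ i))))
  (upTo n))

module Submission where

-- Put x = q + t and u = 1 − t, so that q + 1 = x + u.  For a fixed word σ, summing t^des q^seg over all bar choices factors over the
--     m adjacent pairs: a pair contributes q + t if it is a descent and q + 1 otherwise.
-- (2) Ranks.  Build a permutation letter by letter.  The weight of the next letter only
--     depends on whether it lies below the previous one, so the sum over all completions
--     only depends on the number of unused letters and the rank of the previous letter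
--     among them.  Hence Σ_σ weight(σ) = T m = Σ_s K m s for an explicit recursion K.
-- (3) Closed form.  K m p is expressed through T at smaller arguments, which yields
--     T m = u^m + Σ_{i<m} x u^i C(m+1,i+1) T(m−1−i).  The surjection numbers
--     g(n,k) = k! S(n,k) make Σ_k x^k u^(m−k) g(m+1,k+1) satisfy the same recursion,
--     so both agree by strong induction.
-- (4) Right-hand side.  Grouping the terms by k = i + j, the binomial theorem
--     Σ_i C(k,i) (2t)^i (q−t)^(k−i) = (q+t)^k turns the right-hand side into that closed form.

open import Defs
open import Data.Nat as ℕ using (ℕ; zero; suc; NonZero; _≤_; _<_; z≤n; s≤s; _∸_; _!; _<ᵇ_)
import Data.Nat.Properties as ℕP
import Data.Nat.Tactic.RingSolver as ℕSolver
open import Data.Nat.Induction using (<-rec)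
open import Data.Nat.Combinatorics using (_C_; nCk+nC[k+1]≡[n+1]C[k+1]; nCk≡nC[n∸k]; k>n⇒nCk≡0)
open import Data.Integer using (ℤ; +_; _+_; _*_; _-_; 0ℤ; 1ℤ; _^_)
open import Data.Integer.Properties hiding (_≟_)
open import Data.Integer.Tactic.RingSolver using (solve-∀)
open import Algebra.Bundles using (AbelianGroup)
open import Algebra.Properties.Group (AbelianGroup.group +-0-abelianGroup) using () renaming (∙-cancelˡ to +-cancelˡ)
open import Data.Fin as F using (Fin; toℕ; _≟_)
open import Data.List using (List; []; _∷_; map; length; concatMap; _++_; allFin; filter; filterᵇ; upTo; applyUpTo)
open import Data.List.Properties using (length-map; length-tabulate)
open import Data.List.Relation.Unary.All as All using (All; []; _∷_)
import Data.List.Relation.Unary.All.Properties as AllP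
open import Data.List.Relation.Unary.AllPairs using (AllPairs; []; _∷_)
import Data.List.Relation.Unary.AllPairs.Properties as AllPairsP
open import Data.List.Relation.Unary.Any using (here; there)
open import Data.List.Membership.Propositional using (_∈_)
open import Data.List.Membership.Propositional.Properties using (∈-allFin)
open import Data.Bool as Bool using (Bool; true; false; if_then_else_; not; _∧_)
import Data.Bool.Properties as BoolP
open import Data.Product using (_,_)
open import Data.Empty using (⊥-elim; ⊥-elim-irr)
open import Relation.Nullary using (¬_; yes; no)
open import Relation.Nullary.Decidable using (⌊_⌋; does)
open import Relation.Unary using (Decidable)
open import Relation.Binary.PropositionalEquality

∑ : ℕ → (ℕ → ℤ) → ℤ
∑ zero    f = 0ℤ
∑ (suc n) f = f 0 + ∑ n (λ i → f (suc i))

∑-cong : ∀ n {f g : ℕ → ℤ} → (∀ i → i < n → f i ≡ g i) → ∑ n f ≡ ∑ n g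
∑-cong zero    h = refl
∑-cong (suc n) h = cong₂ _+_ (h 0 (s≤s z≤n)) (∑-cong n (λ i i<n → h (suc i) (s≤s i<n)))

∑-cong′ : ∀ n {f g : ℕ → ℤ} → (∀ i → f i ≡ g i) → ∑ n f ≡ ∑ n g
∑-cong′ n h = ∑-cong n (λ i _ → h i)

∑-zero : ∀ n {f : ℕ → ℤ} → (∀ i → i < n → f i ≡ 0ℤ) → ∑ n f ≡ 0ℤ
∑-zero zero    h = refl
∑-zero (suc n) h = cong₂ _+_ (h 0 (s≤s z≤n)) (∑-zero n (λ i i<n → h (suc i) (s≤s i<n)))

∑-+ : ∀ n (f g : ℕ → ℤ) → ∑ n (λ i → f i + g i) ≡ ∑ n f + ∑ n g
∑-+ zero    f g = refl
∑-+ (suc n) f g = trans (cong (_+_ (f 0 + g 0)) (∑-+ n _ _)) (interchange (f 0) (g 0) _ _)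
  where
  interchange : ∀ a b c d → a + b + (c + d) ≡ a + c + (b + d)
  interchange = solve-∀

∑-*ˡ : ∀ n c (f : ℕ → ℤ) → ∑ n (λ i → c * f i) ≡ c * ∑ n f
∑-*ˡ zero    c f = sym (*-zeroʳ c)
∑-*ˡ (suc n) c f = trans (cong (_+_ (c * f 0)) (∑-*ˡ n c _)) (sym (*-distribˡ-+ c (f 0) _))

∑-*ʳ : ∀ n c (f : ℕ → ℤ) → ∑ n (λ i → f i * c) ≡ ∑ n f * c
∑-*ʳ n c f = trans (∑-cong′ n (λ i → *-comm (f i) c)) (trans (∑-*ˡ n c f) (*-comm c _))

∑-last : ∀ n (f : ℕ → ℤ) → ∑ (suc n) f ≡ ∑ n f + f n
∑-last zero    f = trans (+-identityʳ (f 0)) (sym (+-identityˡ (f 0)))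
∑-last (suc n) f = trans (cong (_+_ (f 0)) (∑-last n _)) (sym (+-assoc (f 0) _ _))

∑-split : ∀ m n (f : ℕ → ℤ) → ∑ (m ℕ.+ n) f ≡ ∑ m f + ∑ n (λ i → f (m ℕ.+ i))
∑-split zero    n f = sym (+-identityˡ _)
∑-split (suc m) n f = trans (cong (_+_ (f 0)) (∑-split m n _)) (sym (+-assoc (f 0) _ _))

∑-swap : ∀ m n (f : ℕ → ℕ → ℤ) → ∑ m (λ i → ∑ n (f i)) ≡ ∑ n (λ j → ∑ m (λ i → f i j))
∑-swap zero    n f = sym (∑-zero n (λ _ _ → refl))
∑-swap (suc m) n f = trans (cong (_+_ (∑ n (f 0))) (∑-swap m n _)) (sym (∑-+ n (f 0) _))

∑-triangle : ∀ n (g : ℕ → ℕ → ℤ) →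
  ∑ n (λ i → ∑ (n ∸ i) (g i)) ≡ ∑ n (λ k → ∑ (suc k) (λ i → g i (k ∸ i)))
∑-triangle zero    g = refl
∑-triangle (suc n) g = begin
    ∑ (suc n) (g 0) + ∑ n (λ i → ∑ (n ∸ i) (g (suc i)))
  ≡⟨ cong (_+_ (∑ (suc n) (g 0))) (∑-triangle n (λ i → g (suc i))) ⟩
    ∑ (suc n) (g 0) + ∑ n (λ k → ∑ (suc k) (λ i → g (suc i) (k ∸ i)))
  ≡⟨ cong (_+_ (∑ (suc n) (g 0))) (sym (+-identityˡ _)) ⟩
    ∑ (suc n) (g 0) + ∑ (suc n) (λ k → ∑ k (λ i → g (suc i) (k ∸ suc i)))
  ≡⟨ sym (∑-+ (suc n) (g 0) (λ k → ∑ k (λ i → g (suc i) (k ∸ suc i)))) ⟩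
    ∑ (suc n) (λ k → ∑ (suc k) (λ i → g i (k ∸ i))) ∎
  where open ≡-Reasoning

∑-extend : ∀ n N (f : ℕ → ℤ) → n ≤ N → (∀ k → n ≤ k → k < N → f k ≡ 0ℤ) → ∑ n f ≡ ∑ N f
∑-extend n N f n≤N h = begin
    ∑ n f                                  ≡⟨ sym (+-identityʳ _) ⟩
    ∑ n f + 0ℤ                             ≡⟨ cong (_+_ (∑ n f)) (sym (∑-zero (N ∸ n) tail-vanishes)) ⟩
    ∑ n f + ∑ (N ∸ n) (λ i → f (n ℕ.+ i))  ≡⟨ sym (∑-split n (N ∸ n) f) ⟩
    ∑ (n ℕ.+ (N ∸ n)) f                    ≡⟨ cong (λ z → ∑ z f) (ℕP.m+[n∸m]≡n n≤N) ⟩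
    ∑ N f                                  ∎
  where
  open ≡-Reasoning
  tail-vanishes : ∀ i → i < N ∸ n → f (n ℕ.+ i) ≡ 0ℤ
  tail-vanishes i i< = h (n ℕ.+ i) (ℕP.m≤m+n n i)
    (subst (n ℕ.+ i <_) (ℕP.m+[n∸m]≡n n≤N) (ℕP.+-monoʳ-< n i<))

sumMap : {A : Set} → (A → ℤ) → List A → ℤ
sumMap f xs = sumℤ (map f xs)

sumMap-++ : {A : Set} (f : A → ℤ) (xs ys : List A) → sumMap f (xs ++ ys) ≡ sumMap f xs + sumMap f ys
sumMap-++ f []       ys = sym (+-identityˡ _)
sumMap-++ f (x ∷ xs) ys = trans (cong (_+_ (f x)) (sumMap-++ f xs ys)) (sym (+-assoc (f x) _ _))

sumMap-map : {A B : Set} (f : B → ℤ) (g : A → B) (xs : List A) →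
  sumMap f (map g xs) ≡ sumMap (λ a → f (g a)) xs
sumMap-map f g []       = refl
sumMap-map f g (x ∷ xs) = cong (_+_ (f (g x))) (sumMap-map f g xs)

sumMap-concatMap : {A B : Set} (f : B → ℤ) (g : A → List B) (xs : List A) →
  sumMap f (concatMap g xs) ≡ sumMap (λ a → sumMap f (g a)) xs
sumMap-concatMap f g []       = refl
sumMap-concatMap f g (x ∷ xs) =
  trans (sumMap-++ f (g x) (concatMap g xs)) (cong (_+_ (sumMap f (g x))) (sumMap-concatMap f g xs))

sumMap-cong : {A : Set} {f g : A → ℤ} (xs : List A) → (∀ a → f a ≡ g a) → sumMap f xs ≡ sumMap g xs
sumMap-cong []       h = refl
sumMap-cong (x ∷ xs) h = cong₂ _+_ (h x) (sumMap-cong xs h)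

sumMap-congᴬ : {A : Set} {f g : A → ℤ} {xs : List A} → All (λ a → f a ≡ g a) xs → sumMap f xs ≡ sumMap g xs
sumMap-congᴬ []       = refl
sumMap-congᴬ (p ∷ ps) = cong₂ _+_ p (sumMap-congᴬ ps)

sumMap-*ˡ : {A : Set} (c : ℤ) (f : A → ℤ) (xs : List A) → sumMap (λ a → c * f a) xs ≡ c * sumMap f xs
sumMap-*ˡ c f []       = sym (*-zeroʳ c)
sumMap-*ˡ c f (x ∷ xs) = trans (cong (_+_ (c * f x)) (sumMap-*ˡ c f xs)) (sym (*-distribˡ-+ c (f x) _))

sumMap-if : {A : Set} (b : Bool) (f : A → ℤ) (xs : List A) →
  sumMap (λ a → if b then f a else 0ℤ) xs ≡ (if b then sumMap f xs else 0ℤ)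
sumMap-if true  f xs       = refl
sumMap-if false f []       = refl
sumMap-if false f (x ∷ xs) = trans (+-identityˡ _) (sumMap-if false f xs)

sumMap-applyUpTo : (f : ℕ → ℤ) (g : ℕ → ℕ) (n : ℕ) → sumMap f (applyUpTo g n) ≡ ∑ n (λ i → f (g i))
sumMap-applyUpTo f g zero    = refl
sumMap-applyUpTo f g (suc n) = cong (_+_ (f (g 0))) (sumMap-applyUpTo f (λ i → g (suc i)) n)

sumMap-upTo : (f : ℕ → ℤ) (n : ℕ) → sumMap f (upTo n) ≡ ∑ n f
sumMap-upTo f n = sumMap-applyUpTo f (λ i → i) n

-- Binomial coefficients as integers.  Bin and Surj below are opaque so that unification and
-- the ring solver treat them as atoms instead of unfolding their arithmetic definitions.
opaque
  Bin : ℕ → ℕ → ℤ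
  Bin n k = + (n C k)

  Bin-def : ∀ n k → Bin n k ≡ + (n C k)
  Bin-def n k = refl

  Bin-n0 : ∀ n → Bin n 0 ≡ 1ℤ
  Bin-n0 n = refl

  Bin-pascal : ∀ n k → Bin (suc n) (suc k) ≡ Bin n k + Bin n (suc k)
  Bin-pascal n k = trans (cong +_ (sym (nCk+nC[k+1]≡[n+1]C[k+1] n k))) (pos-+ (n C k) (n C suc k))

  Bin-vanish : ∀ n k → n < k → Bin n k ≡ 0ℤ
  Bin-vanish n k n<k = cong +_ (k>n⇒nCk≡0 n<k)

-- In Σ_{b ≤ n+1} C(n,b) f(b, n+1−b) the term b = n+1 vanishes, and n+1−b = (n−b)+1 for the rest.
∑-Bin-extend : ∀ n (f : ℕ → ℕ → ℤ) →
  ∑ (suc (suc n)) (λ b → Bin n b * f b (suc n ∸ b)) ≡ ∑ (suc n) (λ b → Bin n b * f b (suc (n ∸ b)))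
∑-Bin-extend n f = begin
    ∑ (suc (suc n)) (λ b → Bin n b * f b (suc n ∸ b))
  ≡⟨ ∑-last (suc n) (λ b → Bin n b * f b (suc n ∸ b)) ⟩
    ∑ (suc n) (λ b → Bin n b * f b (suc n ∸ b)) + Bin n (suc n) * f (suc n) (suc n ∸ suc n)
  ≡⟨ cong₂ _+_ (∑-cong (suc n) (λ b b< → cong (λ e → Bin n b * f b e) (ℕP.+-∸-assoc 1 (ℕP.≤-pred b<))))
               (trans (cong (_* f (suc n) (n ∸ n)) (Bin-vanish n (suc n) (ℕP.n<1+n n))) (*-zeroˡ (f (suc n) (n ∸ n)))) ⟩
    ∑ (suc n) (λ b → Bin n b * f b (suc (n ∸ b))) + 0ℤ
  ≡⟨ +-identityʳ _ ⟩
    ∑ (suc n) (λ b → Bin n b * f b (suc (n ∸ b))) ∎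
  where open ≡-Reasoning

binomialSum : ℤ → ℤ → ℕ → ℤ
binomialSum a b k = ∑ (suc k) (λ i → Bin k i * (a ^ i * b ^ (k ∸ i)))

binomial-theorem : ∀ a b k → binomialSum a b k ≡ (a + b) ^ k
binomial-theorem a b zero    = trans (+-identityʳ _) (trans (cong (_* (1ℤ * 1ℤ)) (Bin-n0 0)) refl)
binomial-theorem a b (suc k) = begin
    Bin (suc k) 0 * (1ℤ * b ^ suc k) + ∑ (suc k) (λ i → Bin (suc k) (suc i) * (a ^ suc i * b ^ (k ∸ i)))
  ≡⟨ cong (_+_ (Bin (suc k) 0 * (1ℤ * b ^ suc k)))
       (trans (∑-cong′ (suc k) pascal-split) (trans (∑-+ (suc k) (λ i → a * term i) upper) (cong (_+ R) (∑-*ˡ (suc k) a term)))) ⟩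
    Bin (suc k) 0 * (1ℤ * b ^ suc k) + (a * P + R)
  ≡⟨ swap-head (Bin (suc k) 0 * (1ℤ * b ^ suc k)) (a * P) R ⟩
    a * P + (Bin (suc k) 0 * (1ℤ * b ^ suc k) + R)
  ≡⟨ cong (_+_ (a * P)) lower-part ⟩
    a * P + b * P
  ≡⟨ sym (*-distribʳ-+ P a b) ⟩
    (a + b) * P
  ≡⟨ cong ((a + b) *_) (binomial-theorem a b k) ⟩
    (a + b) ^ suc k ∎
  where
  open ≡-Reasoning
  term upper : ℕ → ℤ
  term i = Bin k i * (a ^ i * b ^ (k ∸ i))
  upper i = Bin k (suc i) * (a ^ suc i * b ^ (k ∸ i))
  P = ∑ (suc k) term
  R = ∑ (suc k) upper
  swap-head : ∀ x y z → x + (y + z) ≡ y + (x + z)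
  swap-head = solve-∀
  pascal-split : ∀ i → Bin (suc k) (suc i) * (a ^ suc i * b ^ (k ∸ i)) ≡ a * term i + upper i
  pascal-split i = trans (cong (_* (a ^ suc i * b ^ (k ∸ i))) (Bin-pascal k i)) (ring a (Bin k i) (Bin k (suc i)) (a ^ i) (b ^ (k ∸ i)))
    where
    ring : ∀ a c₀ c₁ aⁱ bʲ → (c₀ + c₁) * (a * aⁱ * bʲ) ≡ a * (c₀ * (aⁱ * bʲ)) + c₁ * (a * aⁱ * bʲ)
    ring = solve-∀
  lower-part : Bin (suc k) 0 * (1ℤ * b ^ suc k) + R ≡ b * P
  lower-part = begin
      Bin (suc k) 0 * (1ℤ * b ^ suc k) + R
    ≡⟨ cong (λ c → c * (1ℤ * b ^ suc k) + R) (trans (Bin-n0 (suc k)) (sym (Bin-n0 k))) ⟩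
      ∑ (suc (suc k)) (λ i → Bin k i * (a ^ i * b ^ (suc k ∸ i)))
    ≡⟨ ∑-Bin-extend k (λ i e → a ^ i * b ^ e) ⟩
      ∑ (suc k) (λ i → Bin k i * (a ^ i * (b * b ^ (k ∸ i))))
    ≡⟨ ∑-cong′ (suc k) (λ i → ring b (Bin k i) (a ^ i) (b ^ (k ∸ i))) ⟩
      ∑ (suc k) (λ i → b * term i)
    ≡⟨ ∑-*ˡ (suc k) b term ⟩
      b * P ∎
    where
    ring : ∀ b c aⁱ bʲ → c * (aⁱ * (b * bʲ)) ≡ b * (c * (aⁱ * bʲ))
    ring = solve-∀

S-vanish : ∀ n k → n < k → S n k ≡ 0
S-vanish zero    (suc k) _       = refl
S-vanish (suc n) (suc k) (s≤s p) = begin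
    suc k ℕ.* S n (suc k) ℕ.+ S n k  ≡⟨ cong₂ (λ a b → suc k ℕ.* a ℕ.+ b) (S-vanish n (suc k) (ℕP.m<n⇒m<1+n p)) (S-vanish n k p) ⟩
    suc k ℕ.* 0 ℕ.+ 0                ≡⟨ trans (ℕP.+-identityʳ (suc k ℕ.* 0)) (ℕP.*-zeroʳ (suc k)) ⟩
    0                                ∎
  where open ≡-Reasoning

S-one : ∀ n → S (suc n) 1 ≡ 1
S-one zero    = refl
S-one (suc n) = cong (λ s → s ℕ.+ 0 ℕ.+ 0) (S-one n)

-- Surj n k = k! S(n,k), the number of surjections from an n-set onto a k-set.
opaque
  Surj : ℕ → ℕ → ℤ
  Surj n k = + (k ! ℕ.* S n k)

  Surj-def : ∀ n k → Surj n k ≡ + (k ! ℕ.* S n k)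
  Surj-def n k = refl

  Surj-vanish : ∀ n k → n < k → Surj n k ≡ 0ℤ
  Surj-vanish n k n<k = cong +_ (trans (cong (k ! ℕ.*_) (S-vanish n k n<k)) (ℕP.*-zeroʳ (k !)))

  Surj-suc-0 : ∀ n → Surj (suc n) 0 ≡ 0ℤ
  Surj-suc-0 n = refl

  Surj-suc-1 : ∀ n → Surj (suc n) 1 ≡ 1ℤ
  Surj-suc-1 n = cong +_ (trans (ℕP.+-identityʳ (S (suc n) 1)) (S-one n))

  -- There is exactly one map from an n-set to a point; it is onto iff n > 0.
  Surj-0+1 : ∀ n → Surj n 0 + Surj n 1 ≡ 1ℤ
  Surj-0+1 zero    = refl
  Surj-0+1 (suc n) = Surj-suc-1 n

  -- g(n+1,k+1) = (k+1)(g(n,k+1) + g(n,k)): the new element takes one of k+1 values,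
  -- which is either also hit by the other elements or not.
  Surj-step : ∀ n k → Surj (suc n) (suc k) ≡ + suc k * (Surj n (suc k) + Surj n k)
  Surj-step n k = begin
      + ((suc k ℕ.* k !) ℕ.* (suc k ℕ.* S n (suc k) ℕ.+ S n k))
    ≡⟨ cong +_ (distribute (suc k) (k !) (S n (suc k)) (S n k)) ⟩
      + (suc k ℕ.* ((suc k ℕ.* k !) ℕ.* S n (suc k) ℕ.+ k ! ℕ.* S n k))
    ≡⟨ pos-* (suc k) _ ⟩
      + suc k * + ((suc k ℕ.* k !) ℕ.* S n (suc k) ℕ.+ k ! ℕ.* S n k)
    ≡⟨ cong (+ suc k *_) (pos-+ (suc k ! ℕ.* S n (suc k)) (k ! ℕ.* S n k)) ⟩
      + suc k * (Surj n (suc k) + Surj n k) ∎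
    where
    open ≡-Reasoning
    distribute : ∀ c f s₁ s₀ → (c ℕ.* f) ℕ.* (c ℕ.* s₁ ℕ.+ s₀) ≡ c ℕ.* ((c ℕ.* f) ℕ.* s₁ ℕ.+ f ℕ.* s₀)
    distribute = ℕSolver.solve-∀

fibreSum : ℕ → ℕ → ℤ
fibreSum n k = ∑ (suc n) (λ b → Bin n b * Surj (n ∸ b) k)

-- Pascal's rule applied to every C(n+1,b).
fibreSum-suc : ∀ n k → fibreSum (suc n) k ≡ fibreSum n k + ∑ (suc n) (λ b → Bin n b * Surj (suc (n ∸ b)) k)
fibreSum-suc n k = begin
    Bin (suc n) 0 * Surj (suc n) k + ∑ (suc n) (λ b → Bin (suc n) (suc b) * Surj (n ∸ b) k)
  ≡⟨ cong₂ _+_ (cong (_* Surj (suc n) k) (trans (Bin-n0 (suc n)) (sym (Bin-n0 n)))) (∑-cong′ (suc n) pascal) ⟩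
    Bin n 0 * Surj (suc n) k + ∑ (suc n) (λ b → Bin n b * Surj (n ∸ b) k + Bin n (suc b) * Surj (n ∸ b) k)
  ≡⟨ cong (_+_ (Bin n 0 * Surj (suc n) k)) (∑-+ (suc n) (λ b → Bin n b * Surj (n ∸ b) k) upper) ⟩
    Bin n 0 * Surj (suc n) k + (fibreSum n k + ∑ (suc n) upper)
  ≡⟨ swap-head (Bin n 0 * Surj (suc n) k) (fibreSum n k) (∑ (suc n) upper) ⟩
    fibreSum n k + ∑ (suc (suc n)) (λ b → Bin n b * Surj (suc n ∸ b) k)
  ≡⟨ cong (_+_ (fibreSum n k)) (∑-Bin-extend n (λ _ e → Surj e k)) ⟩
    fibreSum n k + ∑ (suc n) (λ b → Bin n b * Surj (suc (n ∸ b)) k) ∎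
  where
  open ≡-Reasoning
  upper : ℕ → ℤ
  upper b = Bin n (suc b) * Surj (n ∸ b) k
  pascal : ∀ b → Bin (suc n) (suc b) * Surj (n ∸ b) k ≡ Bin n b * Surj (n ∸ b) k + upper b
  pascal b = trans (cong (_* Surj (n ∸ b) k) (Bin-pascal n b)) (*-distribʳ-+ (Surj (n ∸ b) k) (Bin n b) (Bin n (suc b)))
  swap-head : ∀ x y z → x + (y + z) ≡ y + (x + z)
  swap-head = solve-∀

-- Σ_{b ≤ n} C(n,b) g(n−b,k) = g(n,k) + g(n,k+1): choose the fibre (of size b) of an extra
-- point and a surjection of the remaining elements onto k points; this counts surjections
-- onto k + 1 points, together with (for b = 0) the surjections onto the k points alone.
fibreSum≡ : ∀ n k → fibreSum n k ≡ Surj n k + Surj n (suc k)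
fibreSum≡ zero k = begin
    Bin 0 0 * Surj 0 k + 0ℤ         ≡⟨ trans (+-identityʳ _) (cong (_* Surj 0 k) (Bin-n0 0)) ⟩
    1ℤ * Surj 0 k                   ≡⟨ *-identityˡ (Surj 0 k) ⟩
    Surj 0 k                        ≡⟨ sym (+-identityʳ (Surj 0 k)) ⟩
    Surj 0 k + 0ℤ                   ≡⟨ cong (_+_ (Surj 0 k)) (sym (Surj-vanish 0 (suc k) (s≤s z≤n))) ⟩
    Surj 0 k + Surj 0 (suc k)       ∎
  where open ≡-Reasoning
fibreSum≡ (suc n) zero = begin
    fibreSum (suc n) 0
  ≡⟨ fibreSum-suc n 0 ⟩
    fibreSum n 0 + ∑ (suc n) (λ b → Bin n b * Surj (suc (n ∸ b)) 0)
  ≡⟨ cong₂ _+_ (trans (fibreSum≡ n 0) (Surj-0+1 n))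
               (∑-zero (suc n) (λ b _ → trans (cong (Bin n b *_) (Surj-suc-0 (n ∸ b))) (*-zeroʳ (Bin n b)))) ⟩
    1ℤ + 0ℤ
  ≡⟨ sym (Surj-0+1 (suc n)) ⟩
    Surj (suc n) 0 + Surj (suc n) 1 ∎
  where open ≡-Reasoning
fibreSum≡ (suc n) (suc k) = begin
    fibreSum (suc n) (suc k)
  ≡⟨ fibreSum-suc n (suc k) ⟩
    fibreSum n (suc k) + ∑ (suc n) (λ b → Bin n b * Surj (suc (n ∸ b)) (suc k))
  ≡⟨ cong (_+_ (fibreSum n (suc k))) (∑-cong′ (suc n) step) ⟩
    fibreSum n (suc k) + ∑ (suc n) (λ b → c * (Bin n b * Surj (n ∸ b) (suc k)) + c * (Bin n b * Surj (n ∸ b) k))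
  ≡⟨ cong (_+_ (fibreSum n (suc k))) (trans (∑-+ (suc n) (λ b → c * (Bin n b * Surj (n ∸ b) (suc k))) (λ b → c * (Bin n b * Surj (n ∸ b) k)))
                                     (cong₂ _+_ (∑-*ˡ (suc n) c (λ b → Bin n b * Surj (n ∸ b) (suc k))) (∑-*ˡ (suc n) c (λ b → Bin n b * Surj (n ∸ b) k)))) ⟩
    fibreSum n (suc k) + (c * fibreSum n (suc k) + c * fibreSum n k)
  ≡⟨ cong₂ (λ a b → a + (c * a + c * b)) (fibreSum≡ n (suc k)) (fibreSum≡ n k) ⟩
    (g₁ + g₂) + (c * (g₁ + g₂) + c * (g₀ + g₁))
  ≡⟨ regroup c g₀ g₁ g₂ ⟩
    c * (g₁ + g₀) + (1ℤ + c) * (g₂ + g₁)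
  ≡⟨ sym (cong₂ _+_ (Surj-step n k) (Surj-step n (suc k))) ⟩
    Surj (suc n) (suc k) + Surj (suc n) (suc (suc k)) ∎
  where
  open ≡-Reasoning
  c = + suc k
  g₀ = Surj n k
  g₁ = Surj n (suc k)
  g₂ = Surj n (suc (suc k))
  step : ∀ b → Bin n b * Surj (suc (n ∸ b)) (suc k) ≡ c * (Bin n b * Surj (n ∸ b) (suc k)) + c * (Bin n b * Surj (n ∸ b) k)
  step b = trans (cong (Bin n b *_) (Surj-step (n ∸ b) k)) (distribute (Bin n b) c (Surj (n ∸ b) (suc k)) (Surj (n ∸ b) k))
    where
    distribute : ∀ β c s₁ s₀ → β * (c * (s₁ + s₀)) ≡ c * (β * s₁) + c * (β * s₀)
    distribute = solve-∀
  regroup : ∀ c g₀ g₁ g₂ → (g₁ + g₂) + (c * (g₁ + g₂) + c * (g₀ + g₁)) ≡ c * (g₁ + g₀) + (1ℤ + c) * (g₂ + g₁)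
  regroup = solve-∀

-- g(n+1,k+2) = Σ_{i<n} C(n+1,i+1) g(n−i,k+1): the fibre identity for n + 1 without its
-- b = 0 term g(n+1,k+1) and its vanishing b = n + 1 term.
Surj-first-block : ∀ n k → Surj (suc n) (suc (suc k)) ≡ ∑ n (λ i → Bin (suc n) (suc i) * Surj (n ∸ i) (suc k))
Surj-first-block n k = +-cancelˡ (Surj (suc n) (suc k)) _ _ (begin
    Surj (suc n) (suc k) + Surj (suc n) (suc (suc k))
  ≡⟨ sym (fibreSum≡ (suc n) (suc k)) ⟩
    Bin (suc n) 0 * Surj (suc n) (suc k) + ∑ (suc n) (λ i → Bin (suc n) (suc i) * Surj (n ∸ i) (suc k))
  ≡⟨ cong₂ _+_ (trans (cong (_* Surj (suc n) (suc k)) (Bin-n0 (suc n))) (*-identityˡ (Surj (suc n) (suc k))))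
               (∑-last n (λ i → Bin (suc n) (suc i) * Surj (n ∸ i) (suc k))) ⟩
    Surj (suc n) (suc k) + (∑ n (λ i → Bin (suc n) (suc i) * Surj (n ∸ i) (suc k)) + Bin (suc n) (suc n) * Surj (n ∸ n) (suc k))
  ≡⟨ cong (λ z → Surj (suc n) (suc k) + (∑ n (λ i → Bin (suc n) (suc i) * Surj (n ∸ i) (suc k)) + z)) last-vanishes ⟩
    Surj (suc n) (suc k) + (∑ n (λ i → Bin (suc n) (suc i) * Surj (n ∸ i) (suc k)) + 0ℤ)
  ≡⟨ cong (_+_ (Surj (suc n) (suc k))) (+-identityʳ _) ⟩
    Surj (suc n) (suc k) + ∑ n (λ i → Bin (suc n) (suc i) * Surj (n ∸ i) (suc k)) ∎)
  where
  open ≡-Reasoning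
  last-vanishes : Bin (suc n) (suc n) * Surj (n ∸ n) (suc k) ≡ 0ℤ
  last-vanishes = trans (cong (λ m → Bin (suc n) (suc n) * Surj m (suc k)) (ℕP.n∸n≡0 n))
                        (trans (cong (Bin (suc n) (suc n) *_) (Surj-vanish 0 (suc k) (s≤s z≤n))) (*-zeroʳ (Bin (suc n) (suc n))))

module StepWeight (x y : ℤ) where

  step : ℕ → ℕ → ℤ
  step a b = if b <ᵇ a then x else y

  chainWeight : ℕ → List ℕ → ℤ
  chainWeight a []      = 1ℤ
  chainWeight a (b ∷ w) = step a b * chainWeight b w

  wordWeight : List ℕ → ℤ
  wordWeight []      = 1ℤ
  wordWeight (a ∷ w) = chainWeight a w

words-length : {A : Set} (L : List A) (k : ℕ) → All (λ w → length w ≡ k) (words L k)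
words-length L zero    = refl ∷ []
words-length L (suc k) =
  AllP.concat⁺ (AllP.map⁺ (All.universal (λ _ → AllP.map⁺ (All.map (cong suc) (words-length L k))) L))

module BarSum (t q : ℤ) where
  open StepWeight (q + t) (q + 1ℤ)

  segWeight : List ℕ → List Bool → ℤ
  segWeight w bs = t ^ des w bs * q ^ seg w bs

  -- Step (1): summing over the bars of a word with k + 1 letters, each adjacent pair
  -- independently contributes q (bar) plus t (no bar, descent) or 1 (no bar, no descent).
  sum-over-bars : ∀ k (w : List ℕ) → length w ≡ suc k →
    sumMap (segWeight w) (words (true ∷ false ∷ []) k) ≡ wordWeight w
  sum-over-bars zero    (a ∷ [])    refl = refl
  sum-over-bars (suc k) (a ∷ b ∷ r) len = begin
      sumMap (segWeight (a ∷ b ∷ r)) (concatMap (λ c → map (c ∷_) W) (true ∷ false ∷ []))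
    ≡⟨ sumMap-concatMap (segWeight (a ∷ b ∷ r)) (λ c → map (c ∷_) W) (true ∷ false ∷ []) ⟩
      sumMap (segWeight (a ∷ b ∷ r)) (map (true ∷_) W) + (sumMap (segWeight (a ∷ b ∷ r)) (map (false ∷_) W) + 0ℤ)
    ≡⟨ cong₂ (λ u v → u + (v + 0ℤ)) (sumMap-map (segWeight (a ∷ b ∷ r)) (true ∷_) W) (sumMap-map (segWeight (a ∷ b ∷ r)) (false ∷_) W) ⟩
      sumMap (λ bs → t ^ des (b ∷ r) bs * (q * q ^ seg (b ∷ r) bs)) W
        + (sumMap (λ bs → t ^ (D ℕ.+ des (b ∷ r) bs) * q ^ seg (b ∷ r) bs) W + 0ℤ)
    ≡⟨ cong₂ (λ u v → u + (v + 0ℤ)) (trans (sumMap-cong W bar) (sumMap-*ˡ q (segWeight (b ∷ r)) W))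
                                    (trans (sumMap-cong W no-bar) (sumMap-*ˡ (t ^ D) (segWeight (b ∷ r)) W)) ⟩
      q * X + (t ^ D * X + 0ℤ)
    ≡⟨ factor q (t ^ D) X ⟩
      (q + t ^ D) * X
    ≡⟨ cong₂ _*_ first-pair (sum-over-bars k (b ∷ r) (ℕP.suc-injective len)) ⟩
      wordWeight (a ∷ b ∷ r) ∎
    where
    open ≡-Reasoning
    W = words (true ∷ false ∷ []) k
    D = if b <ᵇ a then 1 else 0
    X = sumMap (segWeight (b ∷ r)) W
    bar : ∀ bs → t ^ des (b ∷ r) bs * (q * q ^ seg (b ∷ r) bs) ≡ q * segWeight (b ∷ r) bs
    bar bs = swap (t ^ des (b ∷ r) bs) q (q ^ seg (b ∷ r) bs)
      where
      swap : ∀ a q b → a * (q * b) ≡ q * (a * b)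
      swap = solve-∀
    no-bar : ∀ bs → t ^ (D ℕ.+ des (b ∷ r) bs) * q ^ seg (b ∷ r) bs ≡ t ^ D * segWeight (b ∷ r) bs
    no-bar bs = trans (cong (_* q ^ seg (b ∷ r) bs) (^-distribˡ-+-* t D (des (b ∷ r) bs))) (*-assoc (t ^ D) _ _)
    factor : ∀ q d x → q * x + (d * x + 0ℤ) ≡ (q + d) * x
    factor = solve-∀
    first-pair : q + t ^ D ≡ step a b
    first-pair with b <ᵇ a
    ... | true  = cong (_+_ q) (*-identityʳ t)
    ... | false = refl

-- K m p is the total weight of the arrangements of m unused
-- letters placed after a letter that exceeds exactly p of them: the next letter has some
-- rank s among the unused ones, it is a descent iff s < p, and afterwards exactly s of the
-- remaining letters lie below it.
module RankRecursion (x y : ℤ) where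

  rankStep : ℕ → ℕ → ℤ
  rankStep s p = if s <ᵇ p then x else y

  K : ℕ → ℕ → ℤ
  K zero    p = 1ℤ
  K (suc m) p = ∑ (suc m) (λ s → rankStep s p * K m s)

  -- The total weight of all arrangements of m + 1 letters (the first letter has rank s).
  T : ℕ → ℤ
  T m = ∑ (suc m) (K m)

<ᵇ-irrefl : ∀ m → (m <ᵇ m) ≡ false
<ᵇ-irrefl zero    = refl
<ᵇ-irrefl (suc m) = <ᵇ-irrefl m

<ᵇ-false : ∀ {m n} → n ≤ m → (m <ᵇ n) ≡ false
<ᵇ-false z≤n     = refl
<ᵇ-false (s≤s p) = <ᵇ-false p

<ᵇ-true : ∀ {m n} → m < n → (m <ᵇ n) ≡ true
<ᵇ-true {zero}  (s≤s p) = refl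
<ᵇ-true {suc m} (s≤s p) = <ᵇ-true p

<ᵇ-false⁻¹ : ∀ m n → (m <ᵇ n) ≡ false → n ≤ m
<ᵇ-false⁻¹ m       zero    _ = z≤n
<ᵇ-false⁻¹ zero    (suc n) ()
<ᵇ-false⁻¹ (suc m) (suc n) p = s≤s (<ᵇ-false⁻¹ m n p)

filterᵇ-true : {A : Set} (p : A → Bool) → ∀ c L → p c ≡ true → filterᵇ p (c ∷ L) ≡ c ∷ filterᵇ p L
filterᵇ-true p c L e rewrite e = refl

filterᵇ-false : {A : Set} (p : A → Bool) → ∀ c L → p c ≡ false → filterᵇ p (c ∷ L) ≡ filterᵇ p L
filterᵇ-false p c L e rewrite e = refl

filterᵇ-filterᵇ : {A : Set} (p r : A → Bool) (L : List A) → filterᵇ p (filterᵇ r L) ≡ filterᵇ (λ c → r c ∧ p c) L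
filterᵇ-filterᵇ p r []      = refl
filterᵇ-filterᵇ p r (c ∷ L) with r c
... | false = filterᵇ-filterᵇ p r L
... | true with p c
...   | true  = cong (c ∷_) (filterᵇ-filterᵇ p r L)
...   | false = filterᵇ-filterᵇ p r L

filterᵇ-cong : {A : Set} {p r : A → Bool} (L : List A) → (∀ c → p c ≡ r c) → filterᵇ p L ≡ filterᵇ r L
filterᵇ-cong []            h = refl
filterᵇ-cong {r = r} (c ∷ L) h rewrite h c with r c
... | true  = cong (c ∷_) (filterᵇ-cong L h)
... | false = filterᵇ-cong L h

filterᵇ-all : {A : Set} (p : A → Bool) (L : List A) → All (λ c → p c ≡ true) L → filterᵇ p L ≡ L
filterᵇ-all p []      _        = refl
filterᵇ-all p (c ∷ L) (e ∷ es) rewrite e = cong (c ∷_) (filterᵇ-all p L es)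

sumMap-filter : {A : Set} {P : A → Set} (P? : Decidable P) (h : A → ℤ) (L : List A) →
  sumMap h (filter P? L) ≡ sumMap (λ w → if does (P? w) then h w else 0ℤ) L
sumMap-filter P? h []      = refl
sumMap-filter P? h (c ∷ L) with does (P? c)
... | true  = cong (_+_ (h c)) (sumMap-filter P? h L)
... | false = trans (sumMap-filter P? h L) (sym (+-identityˡ _))

∧-swap : ∀ a b c → a ∧ (b ∧ c) ≡ b ∧ (a ∧ c)
∧-swap a b c = trans (sym (BoolP.∧-assoc a b c)) (trans (cong (_∧ c) (BoolP.∧-comm a b)) (BoolP.∧-assoc b a c))

∧-rearrange : ∀ p q r s → (p ∧ q) ∧ (r ∧ s) ≡ r ∧ (q ∧ (p ∧ s))
∧-rearrange p q r s = begin
    (p ∧ q) ∧ (r ∧ s)  ≡⟨ cong (_∧ (r ∧ s)) (BoolP.∧-comm p q) ⟩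
    (q ∧ p) ∧ (r ∧ s)  ≡⟨ BoolP.∧-assoc q p (r ∧ s) ⟩
    q ∧ (p ∧ (r ∧ s))  ≡⟨ cong (q ∧_) (∧-swap p r s) ⟩
    q ∧ (r ∧ (p ∧ s))  ≡⟨ ∧-swap q r (p ∧ s) ⟩
    r ∧ (q ∧ (p ∧ s))  ∎
  where open ≡-Reasoning

-- A word is scored by the chain weight after a fixed
-- previous letter; the sum over all arrangements of the unused letters only depends on
-- how many letters are unused and how many of them lie below the previous letter.
module Arrangements (n : ℕ) (x y : ℤ) where
  open StepWeight x y
  open RankRecursion x y

  finChainWeight : Fin n → List (Fin n) → ℤ
  finChainWeight a w = chainWeight (toℕ a) (map toℕ w)

  avoids : List (Fin n) → List (Fin n) → Bool
  avoids w []      = true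
  avoids w (e ∷ E) = not (elemFin e w) ∧ avoids w E

  avoids-[] : ∀ E → avoids [] E ≡ true
  avoids-[] []      = refl
  avoids-[] (e ∷ E) = avoids-[] E

  avoids-cons : ∀ b w E → avoids (b ∷ w) E ≡ not (elemFin b E) ∧ avoids w E
  avoids-cons b w []      = refl
  avoids-cons b w (e ∷ E) with e ≟ b | b ≟ e
  ... | yes e≡b | no b≢e  = ⊥-elim (b≢e (sym e≡b))
  ... | no e≢b  | yes b≡e = ⊥-elim (e≢b (sym b≡e))
  ... | yes _   | yes _   = refl
  ... | no _    | no _    = trans (cong (not (elemFin e w) ∧_) (avoids-cons b w E)) (∧-swap (not (elemFin e w)) (not (elemFin b E)) (avoids w E))

  injective-avoiding-cons : ∀ b w E →
    noDup (b ∷ w) ∧ avoids (b ∷ w) E ≡ not (elemFin b E) ∧ (noDup w ∧ avoids w (b ∷ E))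
  injective-avoiding-cons b w E rewrite avoids-cons b w E =
    ∧-rearrange (not (elemFin b w)) (noDup w) (not (elemFin b E)) (avoids w E)

  arrangementSum : List (Fin n) → ℕ → Fin n → ℤ
  arrangementSum E k a =
    sumMap (λ w → if noDup w ∧ avoids w E then finChainWeight a w else 0ℤ) (words (allFin n) k)

  arrangementSum-zero : ∀ E a → arrangementSum E 0 a ≡ 1ℤ
  arrangementSum-zero E a rewrite avoids-[] E = refl

  -- Choosing the first letter b: it must be unused, and it becomes used and the previous letter.
  arrangementSum-suc : ∀ E k a → arrangementSum E (suc k) a
    ≡ sumMap (λ b → if not (elemFin b E) then step (toℕ a) (toℕ b) * arrangementSum (b ∷ E) k b else 0ℤ) (allFin n)
  arrangementSum-suc E k a =
    trans (sumMap-concatMap summand (λ b → map (b ∷_) W) (allFin n)) (sumMap-cong (allFin n) first-letter)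
    where
    W = words (allFin n) k
    summand : List (Fin n) → ℤ
    summand w = if noDup w ∧ avoids w E then finChainWeight a w else 0ℤ
    if-∧ : ∀ c d (u v : ℤ) → (if c ∧ d then u * v else 0ℤ) ≡ (if c then u * (if d then v else 0ℤ) else 0ℤ)
    if-∧ true  true  u v = refl
    if-∧ true  false u v = sym (*-zeroʳ u)
    if-∧ false d     u v = refl
    first-letter : ∀ b → sumMap summand (map (b ∷_) W)
      ≡ (if not (elemFin b E) then step (toℕ a) (toℕ b) * arrangementSum (b ∷ E) k b else 0ℤ)
    first-letter b = begin
        sumMap summand (map (b ∷_) W)
      ≡⟨ sumMap-map summand (b ∷_) W ⟩
        sumMap (λ w → if noDup (b ∷ w) ∧ avoids (b ∷ w) E then s * finChainWeight b w else 0ℤ) W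
      ≡⟨ sumMap-cong W (λ w → trans (cong (λ c → if c then s * finChainWeight b w else 0ℤ) (injective-avoiding-cons b w E))
                                     (if-∧ (not (elemFin b E)) (noDup w ∧ avoids w (b ∷ E)) s (finChainWeight b w))) ⟩
        sumMap (λ w → if not (elemFin b E) then s * rest w else 0ℤ) W
      ≡⟨ sumMap-if (not (elemFin b E)) (λ w → s * rest w) W ⟩
        (if not (elemFin b E) then sumMap (λ w → s * rest w) W else 0ℤ)
      ≡⟨ cong (λ z → if not (elemFin b E) then z else 0ℤ) (sumMap-*ˡ s rest W) ⟩
        (if not (elemFin b E) then s * arrangementSum (b ∷ E) k b else 0ℤ) ∎
      where
      open ≡-Reasoning
      s = step (toℕ a) (toℕ b)
      rest : List (Fin n) → ℤ
      rest w = if noDup w ∧ avoids w (b ∷ E) then finChainWeight b w else 0ℤ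

  unused : List (Fin n) → List (Fin n)
  unused E = filterᵇ (λ c → not (elemFin c E)) (allFin n)

  differs : Fin n → Fin n → Bool
  differs b c = not ⌊ c ≟ b ⌋

  unused-cons : ∀ b E → unused (b ∷ E) ≡ filterᵇ (differs b) (unused E)
  unused-cons b E = sym (trans (filterᵇ-filterᵇ (differs b) (λ c → not (elemFin c E)) (allFin n))
                               (filterᵇ-cong (allFin n) not-elem-cons))
    where
    not-elem-cons : ∀ c → not (elemFin c E) ∧ differs b c ≡ not (elemFin c (b ∷ E))
    not-elem-cons c with c ≟ b
    ... | yes _ = BoolP.∧-zeroʳ (not (elemFin c E))
    ... | no _  = BoolP.∧-identityʳ (not (elemFin c E))

  differs-true : ∀ b c → ¬ (toℕ c ≡ toℕ b) → differs b c ≡ true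
  differs-true b c c≢b with c ≟ b
  ... | yes refl = ⊥-elim (c≢b refl)
  ... | no _     = refl

  differs-self : ∀ b → differs b b ≡ false
  differs-self b with b ≟ b
  ... | yes _   = refl
  ... | no b≢b  = ⊥-elim (b≢b refl)

  rank : List (Fin n) → Fin n → ℕ
  rank []      a = 0
  rank (c ∷ L) a = if toℕ c <ᵇ toℕ a then suc (rank L a) else rank L a

  rank-zero : ∀ L a → All (λ d → toℕ a ≤ toℕ d) L → rank L a ≡ 0
  rank-zero []      a _        = refl
  rank-zero (d ∷ L) a (p ∷ ps) rewrite <ᵇ-false {toℕ d} {toℕ a} p = rank-zero L a ps

  rank-suc : ∀ c L b → toℕ c < toℕ b → rank (c ∷ L) b ≡ suc (rank L b)
  rank-suc c L b c<b rewrite <ᵇ-true c<b = refl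

  Increasing : List (Fin n) → Set
  Increasing = AllPairs (λ c d → toℕ c < toℕ d)

  -- In an increasing list the rank of the s-th letter is s; so a sum over the letters b of
  -- a quantity depending on rank b and on whether b < a is a sum over ranks s, where b < a
  -- becomes s < rank a.
  sum-by-rank : ∀ L → Increasing L → (f : ℕ → Bool → ℤ) (a : Fin n) →
    sumMap (λ b → f (rank L b) (toℕ b <ᵇ toℕ a)) L ≡ ∑ (length L) (λ s → f s (s <ᵇ rank L a))
  sum-by-rank []      _            f a = refl
  sum-by-rank (c ∷ L) (c<L ∷ incr) f a = trans (cong₂ _+_ head tail) regroup
    where
    head : f (rank (c ∷ L) c) (toℕ c <ᵇ toℕ a) ≡ f 0 (toℕ c <ᵇ toℕ a)
    head rewrite <ᵇ-irrefl (toℕ c) | rank-zero L c (All.map ℕP.<⇒≤ c<L) = refl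
    tail : sumMap (λ b → f (rank (c ∷ L) b) (toℕ b <ᵇ toℕ a)) L ≡ ∑ (length L) (λ s → f (suc s) (s <ᵇ rank L a))
    tail = trans (sumMap-congᴬ (All.map (λ {b} c<b → cong (λ r → f r (toℕ b <ᵇ toℕ a)) (rank-suc c L b c<b)) c<L))
                 (sum-by-rank L incr (λ s → f (suc s)) a)
    regroup : f 0 (toℕ c <ᵇ toℕ a) + ∑ (length L) (λ s → f (suc s) (s <ᵇ rank L a))
            ≡ ∑ (suc (length L)) (λ s → f s (s <ᵇ rank (c ∷ L) a))
    regroup with toℕ c <ᵇ toℕ a in c<?a
    ... | true  = refl
    ... | false rewrite rank-zero L a (All.map (λ c<d → ℕP.≤-trans (<ᵇ-false⁻¹ (toℕ c) (toℕ a) c<?a) (ℕP.<⇒≤ c<d)) c<L) = refl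

  allFin-increasing : Increasing (allFin n)
  allFin-increasing = AllPairsP.tabulate⁺-< (λ i<j → i<j)

  unused-increasing : ∀ E → Increasing (unused E)
  unused-increasing E = AllPairsP.filter⁺ (λ c → Bool.T? (not (elemFin c E))) allFin-increasing

  length-remove : ∀ M b → Increasing M → b ∈ M → suc (length (filterᵇ (differs b) M)) ≡ length M
  length-remove (c ∷ M) b (c<M ∷ _) (here refl) =
    cong suc (cong length (trans (filterᵇ-false (differs b) b M (differs-self b))
                                 (filterᵇ-all (differs b) M (All.map (λ b<d → differs-true b _ (λ d≡b → ℕP.<-irrefl (sym d≡b) b<d)) c<M))))
  length-remove (c ∷ M) b (c<M ∷ incr) (there b∈M) =
    trans (cong (λ L → suc (length L)) (filterᵇ-true (differs b) c M (differs-true b c (λ c≡b → ℕP.<-irrefl c≡b (All.lookup c<M b∈M)))))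
          (cong suc (length-remove M b incr b∈M))

  rank-remove : ∀ M b → rank (filterᵇ (differs b) M) b ≡ rank M b
  rank-remove []      b = refl
  rank-remove (c ∷ M) b with c ≟ b
  ... | yes refl rewrite <ᵇ-irrefl (toℕ c) = rank-remove M c
  ... | no _     rewrite rank-remove M b   = refl

  arrangementSum≡K : ∀ k E a → length (unused E) ≡ k → arrangementSum E k a ≡ K k (rank (unused E) a)
  arrangementSum≡K zero    E a _   = arrangementSum-zero E a
  arrangementSum≡K (suc k) E a len = begin
      arrangementSum E (suc k) a
    ≡⟨ arrangementSum-suc E k a ⟩
      sumMap (λ b → if not (elemFin b E) then step (toℕ a) (toℕ b) * arrangementSum (b ∷ E) k b else 0ℤ) (allFin n)
    ≡⟨ sym (sumMap-filter (λ b → Bool.T? (not (elemFin b E))) (λ b → step (toℕ a) (toℕ b) * arrangementSum (b ∷ E) k b) (allFin n)) ⟩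
      sumMap (λ b → step (toℕ a) (toℕ b) * arrangementSum (b ∷ E) k b) (unused E)
    ≡⟨ sumMap-congᴬ (All.tabulate (λ {b} b∈ → cong (step (toℕ a) (toℕ b) *_) (next b b∈))) ⟩
      sumMap (λ b → step (toℕ a) (toℕ b) * K k (rank (unused E) b)) (unused E)
    ≡⟨ sum-by-rank (unused E) (unused-increasing E) (λ s below → (if below then x else y) * K k s) a ⟩
      ∑ (length (unused E)) (λ s → rankStep s (rank (unused E) a) * K k s)
    ≡⟨ cong (λ l → ∑ l (λ s → rankStep s (rank (unused E) a) * K k s)) len ⟩
      K (suc k) (rank (unused E) a) ∎
    where
    open ≡-Reasoning
    next : ∀ b → b ∈ unused E → arrangementSum (b ∷ E) k b ≡ K k (rank (unused E) b)
    next b b∈ = trans (arrangementSum≡K k (b ∷ E) b len′)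
                      (cong (K k) (trans (cong (λ L → rank L b) (unused-cons b E)) (rank-remove (unused E) b)))
      where
      len′ : length (unused (b ∷ E)) ≡ k
      len′ = ℕP.suc-injective (trans (cong (λ L → suc (length L)) (unused-cons b E))
                                     (trans (length-remove (unused E) b (unused-increasing E) b∈) len))

does-≟-true : ∀ b → does (b Bool.≟ true) ≡ b
does-≟-true true  = refl
does-≟-true false = refl

module PermutationSum (m : ℕ) (x y : ℤ) where
  open StepWeight x y
  open RankRecursion x y
  open Arrangements (suc m) x y

  unused-[] : unused [] ≡ allFin (suc m)
  unused-[] = filterᵇ-all (λ c → not (elemFin c [])) (allFin (suc m)) (All.universal (λ _ → refl) (allFin (suc m)))

  length-unused-first : ∀ a → length (unused (a ∷ [])) ≡ m
  length-unused-first a = ℕP.suc-injective (begin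
      suc (length (unused (a ∷ [])))                   ≡⟨ cong (λ L → suc (length L)) (unused-cons a []) ⟩
      suc (length (filterᵇ (differs a) (unused [])))     ≡⟨ cong (λ L → suc (length (filterᵇ (differs a) L))) unused-[] ⟩
      suc (length (filterᵇ (differs a) (allFin (suc m)))) ≡⟨ length-remove (allFin (suc m)) a allFin-increasing (∈-allFin a) ⟩
      length (allFin (suc m))                          ≡⟨ length-tabulate {n = suc m} (λ i → i) ⟩
      suc m                                            ∎)
    where open ≡-Reasoning

  rank-unused-first : ∀ a → rank (unused (a ∷ [])) a ≡ rank (allFin (suc m)) a
  rank-unused-first a = trans (cong (λ L → rank L a) (unused-cons a []))
    (trans (cong (λ L → rank (filterᵇ (differs a) L) a) unused-[]) (rank-remove (allFin (suc m)) a))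

  -- A permutation is a first letter a followed by an injective word avoiding a.
  permutation-sum : sumMap wordWeight (perms (suc m)) ≡ T m
  permutation-sum = begin
      sumMap wordWeight (perms (suc m))
    ≡⟨ sumMap-map wordWeight (map toℕ) injective ⟩
      sumMap (λ w → wordWeight (map toℕ w)) injective
    ≡⟨ sumMap-filter (λ w → noDup w Bool.≟ true) (λ w → wordWeight (map toℕ w)) Wd ⟩
      sumMap (λ w → if does (noDup w Bool.≟ true) then wordWeight (map toℕ w) else 0ℤ) Wd
    ≡⟨ sumMap-cong Wd (λ w → cong (λ c → if c then wordWeight (map toℕ w) else 0ℤ) (does-≟-true (noDup w))) ⟩
      sumMap (λ w → if noDup w then wordWeight (map toℕ w) else 0ℤ) Wd
    ≡⟨ sumMap-concatMap (λ w → if noDup w then wordWeight (map toℕ w) else 0ℤ) (λ a → map (a ∷_) W) (allFin (suc m)) ⟩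
      sumMap (λ a → sumMap (λ w → if noDup w then wordWeight (map toℕ w) else 0ℤ) (map (a ∷_) W)) (allFin (suc m))
    ≡⟨ sumMap-cong (allFin (suc m)) first-letter ⟩
      sumMap (λ a → arrangementSum (a ∷ []) m a) (allFin (suc m))
    ≡⟨ sumMap-cong (allFin (suc m)) (λ a → trans (arrangementSum≡K m (a ∷ []) a (length-unused-first a)) (cong (K m) (rank-unused-first a))) ⟩
      sumMap (λ a → K m (rank (allFin (suc m)) a)) (allFin (suc m))
    ≡⟨ sum-by-rank (allFin (suc m)) allFin-increasing (λ s _ → K m s) F.zero ⟩
      ∑ (length (allFin (suc m))) (K m)
    ≡⟨ cong (λ l → ∑ l (K m)) (length-tabulate {n = suc m} (λ i → i)) ⟩
      T m ∎
    where
    open ≡-Reasoning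
    Wd = words (allFin (suc m)) (suc m)
    W = words (allFin (suc m)) m
    injective = filter (λ w → noDup w Bool.≟ true) Wd
    first-letter : ∀ a → sumMap (λ w → if noDup w then wordWeight (map toℕ w) else 0ℤ) (map (a ∷_) W) ≡ arrangementSum (a ∷ []) m a
    first-letter a = trans (sumMap-map (λ w → if noDup w then wordWeight (map toℕ w) else 0ℤ) (a ∷_) W)
      (sumMap-cong W (λ w → cong (λ c → if c then finChainWeight a w else 0ℤ) (reorder (not (elemFin a w)) (noDup w))))
      where
      reorder : ∀ p q → p ∧ q ≡ q ∧ (p ∧ true)
      reorder p q = trans (BoolP.∧-comm p q) (cong (q ∧_) (sym (BoolP.∧-identityʳ p)))

  permutations-length : All (λ w → length w ≡ suc m) (perms (suc m))
  permutations-length = AllP.map⁺ (All.map (λ {w} len → trans (length-map toℕ w) len)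
    (AllP.filter⁺ (λ w → noDup w Bool.≟ true) (words-length (allFin (suc m)) (suc m))))

atLeast : ℕ → ℕ → ℤ
atLeast s p = if s <ᵇ p then 0ℤ else 1ℤ

isZero : ℕ → ℤ
isZero zero    = 1ℤ
isZero (suc _) = 0ℤ

∑-isZero : ∀ m → ∑ (suc m) isZero ≡ 1ℤ
∑-isZero m = cong (_+_ 1ℤ) (∑-zero m (λ _ _ → refl))

∑-atLeast-isZero : ∀ m p → ∑ (suc m) (λ s → atLeast s p * isZero s) ≡ isZero p
∑-atLeast-isZero m p =
  trans (cong₂ _+_ (trans (*-identityʳ (atLeast 0 p)) (atLeast-0 p)) (∑-zero m (λ s _ → *-zeroʳ (atLeast (suc s) p))))
        (+-identityʳ (isZero p))
  where
  atLeast-0 : ∀ p → atLeast 0 p ≡ isZero p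
  atLeast-0 zero    = refl
  atLeast-0 (suc p) = refl

hockey-stick : ∀ m i → ∑ (suc m) (λ s → Bin (m ∸ s) i) ≡ Bin (suc m) (suc i)
hockey-stick zero    i = begin
    Bin 0 i + 0ℤ             ≡⟨ cong (_+_ (Bin 0 i)) (sym (Bin-vanish 0 (suc i) (s≤s z≤n))) ⟩
    Bin 0 i + Bin 0 (suc i)  ≡⟨ sym (Bin-pascal 0 i) ⟩
    Bin 1 (suc i)            ∎
  where open ≡-Reasoning
hockey-stick (suc m) i = trans (cong (_+_ (Bin (suc m) i)) (hockey-stick m i)) (sym (Bin-pascal (suc m) i))

hockey-stick-from : ∀ m p i → p ≤ suc m → ∑ (suc m) (λ s → atLeast s p * Bin (m ∸ s) i) ≡ Bin (suc m ∸ p) (suc i)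
hockey-stick-from m       zero          i _         = trans (∑-cong′ (suc m) (λ s → *-identityˡ (Bin (m ∸ s) i))) (hockey-stick m i)
hockey-stick-from zero    (suc zero)    i _         =
  trans (+-identityʳ (0ℤ * Bin 0 i)) (trans (*-zeroˡ (Bin 0 i)) (sym (Bin-vanish 0 (suc i) (s≤s z≤n))))
hockey-stick-from zero    (suc (suc p)) i (s≤s ())
hockey-stick-from (suc m) (suc p)       i (s≤s p≤m) =
  trans (cong (_+ ∑ (suc m) (λ s → atLeast s p * Bin (m ∸ s) i)) (*-zeroˡ (Bin (suc m) i)))
        (trans (+-identityˡ _) (hockey-stick-from m p i p≤m))

module ClosedForm (x u : ℤ) where
  open RankRecursion x (x + u)

  rankStep-split : ∀ s p → rankStep s p ≡ x + u * atLeast s p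
  rankStep-split s p with s <ᵇ p
  ... | true  = sym (trans (cong (_+_ x) (*-zeroʳ u)) (+-identityʳ x))
  ... | false = sym (cong (_+_ x) (*-identityʳ u))

  Step : (ℕ → ℤ) → ℕ → ℤ
  Step R m = u ^ m + ∑ m (λ i → x * u ^ i * R (m ∸ suc i) * Bin (suc m) (suc i))

  -- Step R m only involves R below m, so the recursion has at most one solution.
  Step-unique : ∀ (R R′ : ℕ → ℤ) → (∀ m → R m ≡ Step R m) → (∀ m → R′ m ≡ Step R′ m) → ∀ m → R m ≡ R′ m
  Step-unique R R′ R-step R′-step = <-rec (λ m → R m ≡ R′ m) agree
    where
    agree : ∀ m → (∀ {j} → j < m → R j ≡ R′ j) → R m ≡ R′ m
    agree m earlier = begin
        R m          ≡⟨ R-step m ⟩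
        Step R m     ≡⟨ cong (_+_ (u ^ m)) (∑-cong m (λ i i<m → cong (λ r → x * u ^ i * r * Bin (suc m) (suc i))
                                                            (earlier (ℕP.∸-monoʳ-< (s≤s z≤n) i<m)))) ⟩
        Step R′ m    ≡⟨ sym (R′-step m) ⟩
        R′ m         ∎
      where open ≡-Reasoning

  coeff : ℕ → ℕ → ℤ
  coeff m i = x * u ^ i * T (m ∸ suc i)

  Kformula : ℕ → ℕ → ℤ
  Kformula m p = ∑ m (λ i → coeff m i * Bin (m ∸ p) i) + u ^ m * isZero p

  -- Summing the formula over s ≥ p: the binomial parts add up by the hockey-stick identity.
  ∑-atLeast-Kformula : ∀ m p → p ≤ suc m →
    ∑ (suc m) (λ s → atLeast s p * Kformula m s) ≡ ∑ m (λ i → coeff m i * Bin (suc m ∸ p) (suc i)) + u ^ m * isZero p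
  ∑-atLeast-Kformula m p p≤ = begin
      ∑ (suc m) (λ s → atLeast s p * Kformula m s)
    ≡⟨ ∑-cong′ (suc m) distribute ⟩
      ∑ (suc m) (λ s → ∑ m (λ i → coeff m i * (atLeast s p * Bin (m ∸ s) i)) + u ^ m * (atLeast s p * isZero s))
    ≡⟨ ∑-+ (suc m) (λ s → ∑ m (λ i → coeff m i * (atLeast s p * Bin (m ∸ s) i))) (λ s → u ^ m * (atLeast s p * isZero s)) ⟩
      ∑ (suc m) (λ s → ∑ m (λ i → coeff m i * (atLeast s p * Bin (m ∸ s) i))) + ∑ (suc m) (λ s → u ^ m * (atLeast s p * isZero s))
    ≡⟨ cong₂ _+_ (∑-swap (suc m) m (λ s i → coeff m i * (atLeast s p * Bin (m ∸ s) i)))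
                 (trans (∑-*ˡ (suc m) (u ^ m) (λ s → atLeast s p * isZero s)) (cong (u ^ m *_) (∑-atLeast-isZero m p))) ⟩
      ∑ m (λ i → ∑ (suc m) (λ s → coeff m i * (atLeast s p * Bin (m ∸ s) i))) + u ^ m * isZero p
    ≡⟨ cong (_+ u ^ m * isZero p) (∑-cong′ m (λ i → trans (∑-*ˡ (suc m) (coeff m i) (λ s → atLeast s p * Bin (m ∸ s) i))
                                                         (cong (coeff m i *_) (hockey-stick-from m p i p≤)))) ⟩
      ∑ m (λ i → coeff m i * Bin (suc m ∸ p) (suc i)) + u ^ m * isZero p ∎
    where
    open ≡-Reasoning
    distribute : ∀ s → atLeast s p * Kformula m s
      ≡ ∑ m (λ i → coeff m i * (atLeast s p * Bin (m ∸ s) i)) + u ^ m * (atLeast s p * isZero s)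
    distribute s = trans (*-distribˡ-+ a (∑ m (λ i → coeff m i * Bin (m ∸ s) i)) (u ^ m * isZero s))
      (cong₂ _+_ (trans (sym (∑-*ˡ m a (λ i → coeff m i * Bin (m ∸ s) i))) (∑-cong′ m (λ i → swap a (coeff m i) (Bin (m ∸ s) i))))
                 (swap a (u ^ m) (isZero s)))
      where
      a = atLeast s p
      swap : ∀ a c b → a * (c * b) ≡ c * (a * b)
      swap = solve-∀

  -- The formula for K, by induction on m: split each rank step as x + u [s ≥ p], use the
  -- formula for K m and sum it over s ≥ p.
  K≡Kformula : ∀ m p → p ≤ m → K m p ≡ Kformula m p
  K≡Kformula zero    zero _  = refl
  K≡Kformula (suc m) p    p≤ = begin
      K (suc m) p
    ≡⟨ ∑-cong′ (suc m) (λ s → trans (cong (_* K m s) (rankStep-split s p)) (split x u (atLeast s p) (K m s))) ⟩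
      ∑ (suc m) (λ s → x * K m s + u * (atLeast s p * K m s))
    ≡⟨ trans (∑-+ (suc m) (λ s → x * K m s) (λ s → u * (atLeast s p * K m s)))
             (cong₂ _+_ (∑-*ˡ (suc m) x (K m)) (∑-*ˡ (suc m) u (λ s → atLeast s p * K m s))) ⟩
      x * T m + u * ∑ (suc m) (λ s → atLeast s p * K m s)
    ≡⟨ cong (λ z → x * T m + u * z) (∑-cong (suc m) (λ s s< → cong (atLeast s p *_) (K≡Kformula m s (ℕP.≤-pred s<)))) ⟩
      x * T m + u * ∑ (suc m) (λ s → atLeast s p * Kformula m s)
    ≡⟨ cong (λ z → x * T m + u * z) (∑-atLeast-Kformula m p p≤) ⟩
      x * T m + u * (Σ′ + u ^ m * isZero p)
    ≡⟨ cong (_+_ (x * T m)) (*-distribˡ-+ u Σ′ (u ^ m * isZero p)) ⟩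
      x * T m + (u * Σ′ + u * (u ^ m * isZero p))
    ≡⟨ cong (λ z → x * T m + (z + u * (u ^ m * isZero p)))
            (trans (sym (∑-*ˡ m u (λ i → coeff m i * B (suc i)))) (∑-cong′ m shift)) ⟩
      x * T m + (∑ m (λ i → coeff (suc m) (suc i) * B (suc i)) + u * (u ^ m * isZero p))
    ≡⟨ regroup x (T m) (∑ m (λ i → coeff (suc m) (suc i) * B (suc i))) u (u ^ m) (isZero p) ⟩
      x * 1ℤ * T m * 1ℤ + ∑ m (λ i → coeff (suc m) (suc i) * B (suc i)) + u * u ^ m * isZero p
    ≡⟨ cong (λ b → x * 1ℤ * T m * b + ∑ m (λ i → coeff (suc m) (suc i) * B (suc i)) + u ^ suc m * isZero p) (sym (Bin-n0 (suc m ∸ p))) ⟩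
      Kformula (suc m) p ∎
    where
    open ≡-Reasoning
    B : ℕ → ℤ
    B = Bin (suc m ∸ p)
    Σ′ = ∑ m (λ i → coeff m i * B (suc i))
    split : ∀ x u a k → (x + u * a) * k ≡ x * k + u * (a * k)
    split = solve-∀
    shift : ∀ i → u * (coeff m i * B (suc i)) ≡ coeff (suc m) (suc i) * B (suc i)
    shift i = ring x u (u ^ i) (T (m ∸ suc i)) (B (suc i))
      where
      ring : ∀ x u uⁱ t b → u * (x * uⁱ * t * b) ≡ x * (u * uⁱ) * t * b
      ring = solve-∀
    regroup : ∀ x t s u uᵐ z → x * t + (s + u * (uᵐ * z)) ≡ x * 1ℤ * t * 1ℤ + s + u * uᵐ * z
    regroup = solve-∀

  -- Summing the formula over all ranks p gives the recursion for T.
  T-recurrence : ∀ m → T m ≡ Step T m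
  T-recurrence m = begin
      T m
    ≡⟨ ∑-cong (suc m) (λ p p< → K≡Kformula m p (ℕP.≤-pred p<)) ⟩
      ∑ (suc m) (Kformula m)
    ≡⟨ ∑-+ (suc m) (λ p → ∑ m (λ i → coeff m i * Bin (m ∸ p) i)) (λ p → u ^ m * isZero p) ⟩
      ∑ (suc m) (λ p → ∑ m (λ i → coeff m i * Bin (m ∸ p) i)) + ∑ (suc m) (λ p → u ^ m * isZero p)
    ≡⟨ cong₂ _+_ (∑-swap (suc m) m (λ p i → coeff m i * Bin (m ∸ p) i))
                 (trans (∑-*ˡ (suc m) (u ^ m) isZero) (trans (cong (u ^ m *_) (∑-isZero m)) (*-identityʳ (u ^ m)))) ⟩
      ∑ m (λ i → ∑ (suc m) (λ p → coeff m i * Bin (m ∸ p) i)) + u ^ m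
    ≡⟨ cong (_+ u ^ m) (∑-cong′ m (λ i → trans (∑-*ˡ (suc m) (coeff m i) (λ p → Bin (m ∸ p) i))
                                              (cong (coeff m i *_) (hockey-stick m i)))) ⟩
      ∑ m (λ i → coeff m i * Bin (suc m) (suc i)) + u ^ m
    ≡⟨ +-comm (∑ m (λ i → coeff m i * Bin (suc m) (suc i))) (u ^ m) ⟩
      Step T m ∎
    where open ≡-Reasoning

  surjSum : ℕ → ℤ
  surjSum m = ∑ (suc m) (λ k → x ^ k * u ^ (m ∸ k) * Surj (suc m) (suc k))

  -- The recursion for the surjection sum: expand each g(m+1,k+2) by the first-block identity
  -- and collect the terms by the block index i.
  surjSum-recurrence : ∀ m → surjSum m ≡ Step surjSum m
  surjSum-recurrence m = begin
      1ℤ * u ^ m * Surj (suc m) 1 + ∑ m (λ k → x ^ suc k * u ^ (m ∸ suc k) * Surj (suc m) (suc (suc k)))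
    ≡⟨ cong₂ _+_ (trans (cong (1ℤ * u ^ m *_) (Surj-suc-1 m)) (trans (*-identityʳ (1ℤ * u ^ m)) (*-identityˡ (u ^ m))))
                 (∑-cong′ m (λ k → trans (cong (x ^ suc k * u ^ (m ∸ suc k) *_) (Surj-first-block m k))
                                         (sym (∑-*ˡ m (x ^ suc k * u ^ (m ∸ suc k)) (λ i → Bin (suc m) (suc i) * Surj (m ∸ i) (suc k)))))) ⟩
      u ^ m + ∑ m (λ k → ∑ m (λ i → term i k))
    ≡⟨ cong (_+_ (u ^ m)) (∑-swap m m (λ k i → term i k)) ⟩
      u ^ m + ∑ m (λ i → ∑ m (term i))
    ≡⟨ cong (_+_ (u ^ m)) (∑-cong m (λ i i<m → sym (row i i<m))) ⟩
      Step surjSum m ∎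
    where
    open ≡-Reasoning
    term : ℕ → ℕ → ℤ
    term i k = x ^ suc k * u ^ (m ∸ suc k) * (Bin (suc m) (suc i) * Surj (m ∸ i) (suc k))
    -- The i-th term of the recursion, as a sum over k; the terms with k > m − 1 − i vanish.
    row : ∀ i → i < m → x * u ^ i * surjSum (m ∸ suc i) * Bin (suc m) (suc i) ≡ ∑ m (term i)
    row i i<m = begin
        x * u ^ i * surjSum d * B
      ≡⟨ cong (_* B) (sym (∑-*ˡ (suc d) (x * u ^ i) summand)) ⟩
        ∑ (suc d) (λ k → x * u ^ i * summand k) * B
      ≡⟨ sym (∑-*ʳ (suc d) B (λ k → x * u ^ i * summand k)) ⟩
        ∑ (suc d) (λ k → x * u ^ i * summand k * B)
      ≡⟨ ∑-cong (suc d) (λ k k≤d → reassociate k (ℕP.≤-pred k≤d)) ⟩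
        ∑ (suc d) (term i)
      ≡⟨ ∑-extend (suc d) m (term i) (subst (suc d ≤_) i+d≡ (s≤s (ℕP.m≤n+m d i))) (λ k d<k _ → vanish k d<k) ⟩
        ∑ m (term i) ∎
      where
      d = m ∸ suc i
      B = Bin (suc m) (suc i)
      summand : ℕ → ℤ
      summand k = x ^ k * u ^ (d ∸ k) * Surj (suc d) (suc k)
      i+d≡ : suc i ℕ.+ d ≡ m
      i+d≡ = ℕP.m+[n∸m]≡n i<m
      d≡ : suc d ≡ m ∸ i
      d≡ = sym (ℕP.+-∸-assoc 1 i<m)
      ring : ∀ x uⁱ xᵏ uʲ g b → x * uⁱ * (xᵏ * uʲ * g) * b ≡ x * xᵏ * (uⁱ * uʲ) * (b * g)
      ring = solve-∀
      reassociate : ∀ k → k ≤ d → x * u ^ i * summand k * B ≡ term i k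
      reassociate k k≤d = trans (ring x (u ^ i) (x ^ k) (u ^ (d ∸ k)) (Surj (suc d) (suc k)) B)
        (cong₂ (λ p n → x ^ suc k * p * (B * Surj n (suc k)))
               (trans (sym (^-distribˡ-+-* u i (d ∸ k))) (cong (u ^_) (trans (sym (ℕP.+-∸-assoc i k≤d)) (cong (_∸ suc k) i+d≡))))
               d≡)
      vanish : ∀ k → suc d ≤ k → term i k ≡ 0ℤ
      vanish k d<k = trans (cong (x ^ suc k * u ^ (m ∸ suc k) *_)
                                 (trans (cong (B *_) (Surj-vanish (m ∸ i) (suc k) (s≤s (subst (_≤ k) d≡ d<k)))) (*-zeroʳ B)))
                           (*-zeroʳ (x ^ suc k * u ^ (m ∸ suc k)))

  T≡surjSum : ∀ m → T m ≡ surjSum m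
  T≡surjSum = Step-unique T surjSum T-recurrence surjSum-recurrence

pos-^ : ∀ m i → + (m ℕ.^ i) ≡ (+ m) ^ i
pos-^ m zero    = refl
pos-^ m (suc i) = trans (pos-* m (m ℕ.^ i)) (cong (+ m *_) (pos-^ m i))

^-distrib-* : ∀ a b i → (a * b) ^ i ≡ a ^ i * b ^ i
^-distrib-* a b zero    = refl
^-distrib-* a b (suc i) = trans (cong (a * b *_) (^-distrib-* a b i)) (interchange a b (a ^ i) (b ^ i))
  where
  interchange : ∀ a b c d → a * b * (c * d) ≡ a * c * (b * d)
  interchange = solve-∀

module RightHandSide (m : ℕ) (t q : ℤ) where

  u : ℤ
  u = + 1 - t

  rhsTerm : ℕ → ℕ → ℤ
  rhsTerm i j = (t ^ i) * ((q - t) ^ j) * ((+ 1 - t) ^ (suc m ∸ i ∸ j ∸ 1))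
      * (+ (2 ℕ.^ i ℕ.* (suc (i ℕ.+ j)) ! ℕ.* ((i ℕ.+ j) C j) ℕ.* S (suc m) (suc (i ℕ.+ j))))

  diagonalWeight : ℕ → ℤ
  diagonalWeight k = u ^ (m ∸ k) * Surj (suc m) (suc k)

  rhsTerm-diagonal : ∀ i j →
    rhsTerm i j ≡ Bin (i ℕ.+ j) i * ((+ 2 * t) ^ i * (q - t) ^ j) * diagonalWeight (i ℕ.+ j)
  rhsTerm-diagonal i j = begin
      rhsTerm i j
    ≡⟨ cong₂ (λ e c → t ^ i * (q - t) ^ j * u ^ e * + (2 ℕ.^ i ℕ.* F ℕ.* c ℕ.* Sₖ)) exponent C-symmetric ⟩
      t ^ i * (q - t) ^ j * u ^ (m ∸ k) * + (2 ℕ.^ i ℕ.* F ℕ.* (k C i) ℕ.* Sₖ)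
    ≡⟨ cong (t ^ i * (q - t) ^ j * u ^ (m ∸ k) *_) cast ⟩
      t ^ i * (q - t) ^ j * u ^ (m ∸ k) * ((+ 2) ^ i * + (k C i) * + (F ℕ.* Sₖ))
    ≡⟨ ring (t ^ i) ((q - t) ^ j) (u ^ (m ∸ k)) ((+ 2) ^ i) (+ (k C i)) (+ (F ℕ.* Sₖ)) ⟩
      + (k C i) * ((+ 2) ^ i * t ^ i * (q - t) ^ j) * (u ^ (m ∸ k) * + (F ℕ.* Sₖ))
    ≡⟨ cong₂ (λ c p → c * (p * (q - t) ^ j) * (u ^ (m ∸ k) * + (F ℕ.* Sₖ))) (sym (Bin-def k i)) (sym (^-distrib-* (+ 2) t i)) ⟩
      Bin k i * ((+ 2 * t) ^ i * (q - t) ^ j) * (u ^ (m ∸ k) * + (F ℕ.* Sₖ))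
    ≡⟨ cong (λ g → Bin k i * ((+ 2 * t) ^ i * (q - t) ^ j) * (u ^ (m ∸ k) * g)) (sym (Surj-def (suc m) (suc k))) ⟩
      Bin k i * ((+ 2 * t) ^ i * (q - t) ^ j) * diagonalWeight k ∎
    where
    open ≡-Reasoning
    k = i ℕ.+ j
    F = suc k !
    Sₖ = S (suc m) (suc k)
    exponent : suc m ∸ i ∸ j ∸ 1 ≡ m ∸ k
    exponent = trans (cong (_∸ 1) (ℕP.∸-+-assoc (suc m) i j))
                     (trans (ℕP.∸-+-assoc (suc m) k 1) (cong (suc m ∸_) (ℕP.+-comm k 1)))
    C-symmetric : k C j ≡ k C i
    C-symmetric = trans (nCk≡nC[n∸k] (ℕP.m≤n+m j i)) (cong (k C_) (ℕP.m+n∸n≡m i j))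
    cast : + (2 ℕ.^ i ℕ.* F ℕ.* (k C i) ℕ.* Sₖ) ≡ (+ 2) ^ i * + (k C i) * + (F ℕ.* Sₖ)
    cast = trans (cong +_ (reorder (2 ℕ.^ i) F (k C i) Sₖ))
                 (trans (pos-* (2 ℕ.^ i ℕ.* (k C i)) (F ℕ.* Sₖ)) (cong (_* + (F ℕ.* Sₖ)) (trans (pos-* (2 ℕ.^ i) (k C i)) (cong (_* + (k C i)) (pos-^ 2 i)))))
      where
      reorder : ∀ p f c s → p ℕ.* f ℕ.* c ℕ.* s ≡ p ℕ.* c ℕ.* (f ℕ.* s)
      reorder = ℕSolver.solve-∀
    ring : ∀ tⁱ qʲ uᵉ p c g → tⁱ * qʲ * uᵉ * (p * c * g) ≡ c * (p * tⁱ * qʲ) * (uᵉ * g)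
    ring = solve-∀

  rhs≡surjSum : rhs (suc m) t q ≡ ClosedForm.surjSum (q + t) u m
  rhs≡surjSum = begin
      sumMap (λ i → sumMap (rhsTerm i) (upTo (suc m ∸ i))) (upTo (suc m))
    ≡⟨ sumMap-upTo (λ i → sumMap (rhsTerm i) (upTo (suc m ∸ i))) (suc m) ⟩
      ∑ (suc m) (λ i → sumMap (rhsTerm i) (upTo (suc m ∸ i)))
    ≡⟨ ∑-cong′ (suc m) (λ i → sumMap-upTo (rhsTerm i) (suc m ∸ i)) ⟩
      ∑ (suc m) (λ i → ∑ (suc m ∸ i) (rhsTerm i))
    ≡⟨ ∑-triangle (suc m) rhsTerm ⟩
      ∑ (suc m) (λ k → ∑ (suc k) (λ i → rhsTerm i (k ∸ i)))
    ≡⟨ ∑-cong′ (suc m) (λ k → ∑-cong (suc k) (λ i i≤k → on-diagonal k i (ℕP.≤-pred i≤k))) ⟩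
      ∑ (suc m) (λ k → ∑ (suc k) (λ i → Bin k i * ((+ 2 * t) ^ i * (q - t) ^ (k ∸ i)) * diagonalWeight k))
    ≡⟨ ∑-cong′ (suc m) (λ k → trans (∑-*ʳ (suc k) (diagonalWeight k) (λ i → Bin k i * ((+ 2 * t) ^ i * (q - t) ^ (k ∸ i))))
                                    (cong (_* diagonalWeight k) (binomial-theorem (+ 2 * t) (q - t) k))) ⟩
      ∑ (suc m) (λ k → (+ 2 * t + (q - t)) ^ k * diagonalWeight k)
    ≡⟨ ∑-cong′ (suc m) (λ k → trans (cong (λ z → z ^ k * diagonalWeight k) (simplify t q))
                                    (sym (*-assoc ((q + t) ^ k) (u ^ (m ∸ k)) (Surj (suc m) (suc k))))) ⟩
      ClosedForm.surjSum (q + t) u m ∎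
    where
    open ≡-Reasoning
    on-diagonal : ∀ k i → i ≤ k → rhsTerm i (k ∸ i) ≡ Bin k i * ((+ 2 * t) ^ i * (q - t) ^ (k ∸ i)) * diagonalWeight k
    on-diagonal k i i≤k = trans (rhsTerm-diagonal i (k ∸ i))
      (cong (λ k′ → Bin k′ i * ((+ 2 * t) ^ i * (q - t) ^ (k ∸ i)) * diagonalWeight k′) (ℕP.m+[n∸m]≡n i≤k))
    simplify : ∀ t q → + 2 * t + (q - t) ≡ q + t
    simplify = solve-∀

α-double-sum : ∀ n t q → α n t q ≡ sumMap (λ w → sumMap (BarSum.segWeight t q w) (bars n)) (perms n)
α-double-sum n t q = trans (sumMap-concatMap _ (λ w → map (w ,_) (bars n)) (perms n))
                           (sumMap-cong (perms n) (λ w → sumMap-map _ (w ,_) (bars n)))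

mainTheorem14 : (n : ℕ) → .{{_ : NonZero n}} → (t q : ℤ) → α n t q ≡ rhs n t q
mainTheorem14 zero    {{nz}} t q = ⊥-elim-irr (NonZero.nonZero nz)
mainTheorem14 (suc m)        t q = begin
    α (suc m) t q
  ≡⟨ α-double-sum (suc m) t q ⟩
    sumMap (λ w → sumMap (BarSum.segWeight t q w) (bars (suc m))) (perms (suc m))
  ≡⟨ sumMap-congᴬ (All.map (λ {w} → BarSum.sum-over-bars t q m w) (PermutationSum.permutations-length m x y)) ⟩
    sumMap (StepWeight.wordWeight x y) (perms (suc m))
  ≡⟨ PermutationSum.permutation-sum m x y ⟩
    RankRecursion.T x y m
  ≡⟨ cong (λ y′ → RankRecursion.T x y′ m) (q+1≡x+u t q) ⟩
    RankRecursion.T x (x + u) m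
  ≡⟨ ClosedForm.T≡surjSum x u m ⟩
    ClosedForm.surjSum x u m
  ≡⟨ sym (RightHandSide.rhs≡surjSum m t q) ⟩
    rhs (suc m) t q ∎
  where
  open ≡-Reasoning
  x = q + t
  y = q + 1ℤ
  u = + 1 - t
  q+1≡x+u : ∀ t q → q + 1ℤ ≡ (q + t) + (+ 1 - t)
  q+1≡x+u = solve-∀
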